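{- Let $F:\mathbb{X}\to\mathbb{Y}$ be a restriction functor between inverse categories. Then $F$ is faithful if and only if $F$ reflects restriction idempotents and is faithful on restriction idempotents.
   Context: A restriction category is a category with an assignment $f\mapsto\overline f:A\to A$ for each $f:A\to B$ such that $\overline f f=f$; $\overline f\,\overline g=\overline g\,\overline f$ and $\overline{\overline g f}=\overline f\,\overline g$ whenever $\mathrm{dom}f=\mathrm{dom}g$; and $f\overline g=\overline{fg}f$ whenever $\mathrm{cod}f=\mathrm{dom}g$ (composition diagrammatic: $fg$ = first $f$ then $g$). A restriction functor is a functor preserving $\overline{(\cdot)}$. A restriction idempotent is an endomorphism $e$ with $e=\overline e$. A map $f$ is a partial isomorphism if there is $g$ with $fg=\overline f$ and $gf=\overline g$; an inverse category is a restriction category in which every map is a partial isomorphism. $F$ reflects restriction idempotents if whenever $h:A\to A$ has $F(h)$ a restriction idempotent, $h$ is a restriction idempotent. $F$ is faithful on restriction idempotents if $F(e)=F(e')$ for parallel restriction idempotents $e,e'$ implies $e=e'$. -}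

module Defs where

open import Level using (Level; _⊔_; suc)
open import Relation.Binary.PropositionalEquality using (_≡_)
open import Data.Product using (Σ; _×_; _,_)

-- Categories with hom-sets and propositional equality of morphisms.
-- Composition is written diagrammatically:  f ⨾ g  = "first f, then g".
record Category (o h : Level) : Set (suc (o ⊔ h)) where
  infixl 9 _⨾_
  field
    Obj   : Set o
    Hom   : Obj → Obj → Set h
    idm   : (A : Obj) → Hom A A
    _⨾_   : {A B C : Obj} → Hom A B → Hom B C → Hom A C
    idˡ   : {A B : Obj} (f : Hom A B) → idm A ⨾ f ≡ f
    idʳ   : {A B : Obj} (f : Hom A B) → f ⨾ idm B ≡ f
    assoc : {A B C D : Obj} (f : Hom A B) (g : Hom B C) (k : Hom C D) →
            (f ⨾ g) ⨾ k ≡ f ⨾ (g ⨾ k)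

record RestrictionCategory (o h : Level) : Set (suc (o ⊔ h)) where
  field
    cat : Category o h
  open Category cat public
  field
    rst : {A B : Obj} → Hom A B → Hom A A
    R1  : {A B : Obj} (f : Hom A B) → rst f ⨾ f ≡ f
    R2  : {A B C : Obj} (f : Hom A B) (g : Hom A C) → rst f ⨾ rst g ≡ rst g ⨾ rst f
    R3  : {A B C : Obj} (f : Hom A B) (g : Hom A C) → rst (rst g ⨾ f) ≡ rst f ⨾ rst g
    R4  : {A B C : Obj} (f : Hom A B) (g : Hom B C) → f ⨾ rst g ≡ rst (f ⨾ g) ⨾ f

module _ {o h : Level} (X : RestrictionCategory o h) where
  open RestrictionCategory X

  IsRestrictionIdempotent : {A : Obj} → Hom A A → Set h
  IsRestrictionIdempotent e = e ≡ rst e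

  IsPartialIso : {A B : Obj} → Hom A B → Set h
  IsPartialIso {A} {B} f = Σ (Hom B A) λ g → (f ⨾ g ≡ rst f) × (g ⨾ f ≡ rst g)

  IsInverseCategory : Set (o ⊔ h)
  IsInverseCategory = {A B : Obj} (f : Hom A B) → IsPartialIso f

record RestrictionFunctor {o₁ h₁ o₂ h₂ : Level}
         (X : RestrictionCategory o₁ h₁) (Y : RestrictionCategory o₂ h₂)
         : Set (o₁ ⊔ h₁ ⊔ o₂ ⊔ h₂) where
  private
    module X = RestrictionCategory X
    module Y = RestrictionCategory Y
  field
    F₀      : X.Obj → Y.Obj
    F₁      : {A B : X.Obj} → X.Hom A B → Y.Hom (F₀ A) (F₀ B)
    F-id    : (A : X.Obj) → F₁ (X.idm A) ≡ Y.idm (F₀ A)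
    F-comp  : {A B C : X.Obj} (f : X.Hom A B) (g : X.Hom B C) →
              F₁ (f X.⨾ g) ≡ F₁ f Y.⨾ F₁ g
    F-rst   : {A B : X.Obj} (f : X.Hom A B) → F₁ (X.rst f) ≡ Y.rst (F₁ f)

module _ {o₁ h₁ o₂ h₂ : Level}
         {X : RestrictionCategory o₁ h₁} {Y : RestrictionCategory o₂ h₂}
         (F : RestrictionFunctor X Y) where
  private
    module X = RestrictionCategory X
    module Y = RestrictionCategory Y
  open RestrictionFunctor F

  Faithful : Set (o₁ ⊔ h₁ ⊔ h₂)
  Faithful = {A B : X.Obj} (f g : X.Hom A B) → F₁ f ≡ F₁ g → f ≡ g

  ReflectsRestrictionIdempotents : Set (o₁ ⊔ h₁ ⊔ h₂)
  ReflectsRestrictionIdempotents =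
    {A : X.Obj} (k : X.Hom A A) →
    IsRestrictionIdempotent Y (F₁ k) → IsRestrictionIdempotent X k

  FaithfulOnRestrictionIdempotents : Set (o₁ ⊔ h₁ ⊔ h₂)
  FaithfulOnRestrictionIdempotents =
    {A : X.Obj} (e e' : X.Hom A A) →
    IsRestrictionIdempotent X e → IsRestrictionIdempotent X e' →
    F₁ e ≡ F₁ e' → e ≡ e'

-- If F(f) = F(g), then f and g have the same restriction, since F is faithful on
-- restriction idempotents. With g* the partial inverse of g, F(g* f) = F(g* g) is a
-- restriction idempotent, so g* f is one too; then f = g (g* f) = g ‾(g* f) = ‾f g = g.
module Submission where

open import Defs
open import Level using (Level)
open import Data.Product using (_×_; _,_)
open import Function.Bundles using (_⇔_; mk⇔)
open import Relation.Binary.PropositionalEquality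
open ≡-Reasoning

module RestrictionProperties {o h : Level} (X : RestrictionCategory o h) where
  open RestrictionCategory X

  rst-idm : (A : Obj) → rst (idm A) ≡ idm A
  rst-idm A = trans (sym (idʳ _)) (R1 (idm A))

  rst-rst : {A B : Obj} (f : Hom A B) → rst (rst f) ≡ rst f
  rst-rst {A} f = begin
    rst (rst f)                ≡⟨ cong rst (sym (idʳ (rst f))) ⟩
    rst (rst f ⨾ idm A)        ≡⟨ R3 (idm A) f ⟩
    rst (idm A) ⨾ rst f        ≡⟨ cong (_⨾ rst f) (rst-idm A) ⟩
    idm A ⨾ rst f              ≡⟨ idˡ (rst f) ⟩
    rst f                      ∎

  ≡rst⇒isRestrictionIdempotent : {A B : Obj} {e : Hom A A} (f : Hom A B) →
    e ≡ rst f → IsRestrictionIdempotent X e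
  ≡rst⇒isRestrictionIdempotent f e≡rst = begin
    _                ≡⟨ e≡rst ⟩
    rst f            ≡⟨ sym (rst-rst f) ⟩
    rst (rst f)      ≡⟨ cong rst (sym e≡rst) ⟩
    rst _            ∎

  rst-isRestrictionIdempotent : {A B : Obj} (f : Hom A B) →
    IsRestrictionIdempotent X (rst f)
  rst-isRestrictionIdempotent f = ≡rst⇒isRestrictionIdempotent f refl

  section-⨾-rst : {A B C : Obj} {g : Hom A B} {g* : Hom B A} (f : Hom A C) →
    g ⨾ g* ≡ rst g → g ⨾ rst (g* ⨾ f) ≡ rst f ⨾ g
  section-⨾-rst {g = g} {g*} f gg*≡rst = begin
    g ⨾ rst (g* ⨾ f)            ≡⟨ R4 g (g* ⨾ f) ⟩
    rst (g ⨾ (g* ⨾ f)) ⨾ g      ≡⟨ cong (λ k → rst k ⨾ g) (sym (assoc g g* f)) ⟩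
    rst ((g ⨾ g*) ⨾ f) ⨾ g      ≡⟨ cong (λ k → rst (k ⨾ f) ⨾ g) gg*≡rst ⟩
    rst (rst g ⨾ f) ⨾ g         ≡⟨ cong (_⨾ g) (R3 f g) ⟩
    (rst f ⨾ rst g) ⨾ g         ≡⟨ assoc (rst f) (rst g) g ⟩
    rst f ⨾ (rst g ⨾ g)         ≡⟨ cong (rst f ⨾_) (R1 g) ⟩
    rst f ⨾ g                   ∎

  partialIso-cancel : {A B : Obj} {f g : Hom A B} (g* : Hom B A) →
    g ⨾ g* ≡ rst g → rst f ≡ rst g →
    IsRestrictionIdempotent X (g* ⨾ f) → f ≡ g
  partialIso-cancel {f = f} {g} g* gg*≡rst rstf≡rstg g*f-idem = begin
    f                       ≡⟨ sym (R1 f) ⟩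
    rst f ⨾ f               ≡⟨ cong (_⨾ f) rstf≡rstg ⟩
    rst g ⨾ f               ≡⟨ cong (_⨾ f) (sym gg*≡rst) ⟩
    (g ⨾ g*) ⨾ f            ≡⟨ assoc g g* f ⟩
    g ⨾ (g* ⨾ f)            ≡⟨ cong (g ⨾_) g*f-idem ⟩
    g ⨾ rst (g* ⨾ f)        ≡⟨ section-⨾-rst f gg*≡rst ⟩
    rst f ⨾ g               ≡⟨ cong (_⨾ g) rstf≡rstg ⟩
    rst g ⨾ g               ≡⟨ R1 g ⟩
    g                       ∎

module _ {o₁ h₁ o₂ h₂ : Level}
    {X : RestrictionCategory o₁ h₁} {Y : RestrictionCategory o₂ h₂}
    (F : RestrictionFunctor X Y) where
  private
    module X = RestrictionCategory X
    module Y = RestrictionCategory Y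
  open RestrictionFunctor F
  open RestrictionProperties X

  F-isRestrictionIdempotent : {A : X.Obj} {e : X.Hom A A} →
    IsRestrictionIdempotent X e → IsRestrictionIdempotent Y (F₁ e)
  F-isRestrictionIdempotent {e = e} e-idem = trans (cong F₁ e-idem) (F-rst e)

  faithful⇒reflectsRestrictionIdempotents :
    Faithful F → ReflectsRestrictionIdempotents F
  faithful⇒reflectsRestrictionIdempotents faithful k Fk-idem =
    faithful k (X.rst k) (trans Fk-idem (sym (F-rst k)))

  faithful⇒faithfulOnRestrictionIdempotents :
    Faithful F → FaithfulOnRestrictionIdempotents F
  faithful⇒faithfulOnRestrictionIdempotents faithful e e' _ _ = faithful e e'

  faithful⇒reflects×faithfulOnRestrictionIdempotents : Faithful F →
    ReflectsRestrictionIdempotents F × FaithfulOnRestrictionIdempotents F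
  faithful⇒reflects×faithfulOnRestrictionIdempotents faithful =
    faithful⇒reflectsRestrictionIdempotents faithful
    , faithful⇒faithfulOnRestrictionIdempotents faithful

  faithfulOnRestrictionIdempotents⇒rst-injective :
    FaithfulOnRestrictionIdempotents F →
    {A B : X.Obj} {f g : X.Hom A B} → F₁ f ≡ F₁ g → X.rst f ≡ X.rst g
  faithfulOnRestrictionIdempotents⇒rst-injective faithfulOnIdem {f = f} {g} Ff≡Fg =
    faithfulOnIdem (X.rst f) (X.rst g)
      (rst-isRestrictionIdempotent f) (rst-isRestrictionIdempotent g)
      (trans (F-rst f) (trans (cong Y.rst Ff≡Fg) (sym (F-rst g))))

  reflects-⨾-isRestrictionIdempotent :
    ReflectsRestrictionIdempotents F →
    {A B : X.Obj} {f g : X.Hom A B} (k : X.Hom B A) →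
    F₁ f ≡ F₁ g → IsRestrictionIdempotent X (k X.⨾ g) →
    IsRestrictionIdempotent X (k X.⨾ f)
  reflects-⨾-isRestrictionIdempotent reflects {f = f} {g} k Ff≡Fg kg-idem =
    reflects (k X.⨾ f) (begin
      F₁ (k X.⨾ f)           ≡⟨ F-comp-eq ⟩
      F₁ (k X.⨾ g)           ≡⟨ F-isRestrictionIdempotent kg-idem ⟩
      Y.rst (F₁ (k X.⨾ g))   ≡⟨ cong Y.rst (sym F-comp-eq) ⟩
      Y.rst (F₁ (k X.⨾ f))   ∎)
    where
    F-comp-eq : F₁ (k X.⨾ f) ≡ F₁ (k X.⨾ g)
    F-comp-eq = trans (F-comp k f) (trans (cong (F₁ k Y.⨾_) Ff≡Fg) (sym (F-comp k g)))

  reflects×faithfulOnRestrictionIdempotents⇒faithful : IsInverseCategory X →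
    ReflectsRestrictionIdempotents F × FaithfulOnRestrictionIdempotents F →
    Faithful F
  reflects×faithfulOnRestrictionIdempotents⇒faithful invX (reflects , faithfulOnIdem) f g Ff≡Fg
    with invX g
  ... | g* , gg*≡rst , g*g≡rst =
    partialIso-cancel g* gg*≡rst
      (faithfulOnRestrictionIdempotents⇒rst-injective faithfulOnIdem Ff≡Fg)
      (reflects-⨾-isRestrictionIdempotent reflects g* Ff≡Fg
        (≡rst⇒isRestrictionIdempotent g* g*g≡rst))

mainTheorem9 : {o₁ h₁ o₂ h₂ : Level}
    {X : RestrictionCategory o₁ h₁} {Y : RestrictionCategory o₂ h₂} →
    IsInverseCategory X → IsInverseCategory Y →
    (F : RestrictionFunctor X Y) →
    Faithful F ⇔ (ReflectsRestrictionIdempotents F × FaithfulOnRestrictionIdempotents F)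
mainTheorem9 invX _ F = mk⇔
  (faithful⇒reflects×faithfulOnRestrictionIdempotents F)
  (reflects×faithfulOnRestrictionIdempotents⇒faithful F invX)
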